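{- Let $\ell\ge 4$ and let $G$ be a $k$-partite graph with parts $V_1,\dots,V_k$. Suppose there exist $A \subseteq V(G)$ and $x_1,\ldots,x_k \in A$ such that: (1) for every $i\in[k]$ and every $u_i \in V_i \setminus A$ we have $N(u_i)=\{x_i\}$, and for every $i\in[k]$ and every $x \in A\setminus (V_i\cup\{x_i\})$ there exists a path on $\ell-1$ vertices connecting $x$ and $x_i$; (2) for any distinct $i,j\in [k]$ there exists a path on $\ell-2$ vertices connecting $x_i$ and $x_j$; (3) $G[A]$ is $C_{\ell}$-saturated (relative to the complete multipartite graph on $A$ with parts $A\cap V_1,\dots,A\cap V_k$). Then $G$ is $C_{\ell}$-saturated relative to the complete $k$-partite graph with parts $V_1,\dots,V_k$.
   Context: All graphs are finite, simple and undirected. A $k$-partite graph has its vertex set partitioned into $k$ independent sets (parts). $N(u)$ is the neighbourhood of $u$, $G[A]$ the induced subgraph, $[k]=\{1,\dots,k\}$. $C_\ell$ is the cycle on $\ell$ vertices; a path on $r$ vertices is denoted $P_r$. A spanning subgraph $H$ of $G$ is $F$-saturated relative to $G$ if $H$ contains no copy of $F$ but $H+e$ contains a copy of $F$ for every $e\in E(G)\setminus E(H)$; for a $k$-partite graph, "$C_\ell$-saturated" means saturated relative to the complete $k$-partite graph on the same parts, i.e. adding any non-edge between two different parts creates a $C_\ell$. -}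

module Defs where

open import Data.Nat using (ℕ; zero; suc; _∸_)
open import Data.Fin using (Fin; toℕ)
open import Data.Fin.Subset using (Subset; _∈_; _∉_)
open import Data.Bool using (Bool; T)
open import Data.Product using (Σ; _×_; ∃; _,_)
open import Data.Sum using (_⊎_)
open import Relation.Nullary using (¬_)
open import Relation.Binary.PropositionalEquality using (_≡_; _≢_)
open import Function.Definitions using (Injective)

record Graph (n : ℕ) : Set where
  field
    adj   : Fin n → Fin n → Bool
    sym   : ∀ u v → adj u v ≡ adj v u
    irref : ∀ u → ¬ T (adj u u)

open Graph public

Adj : ∀ {n} → Graph n → Fin n → Fin n → Set
Adj G u v = T (adj G u v)

IsPartite : ∀ {n k} → Graph n → (Fin n → Fin k) → Set
IsPartite G part = ∀ u v → Adj G u v → part u ≢ part v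

AdjPlus : ∀ {n} → Graph n → Fin n → Fin n → Fin n → Fin n → Set
AdjPlus G u v a b = Adj G a b ⊎ ((a ≡ u × b ≡ v) ⊎ (a ≡ v × b ≡ u))

CycleIn : ∀ {n} (ℓ : ℕ) → (Fin n → Fin n → Set) → Subset n → Set
CycleIn {n} ℓ R S =
  Σ (Fin ℓ → Fin n) λ f →
    Injective _≡_ _≡_ f
    × (∀ i → f i ∈ S)
    × (∀ i j → (suc (toℕ i) ≡ toℕ j ⊎ (suc (toℕ i) ≡ ℓ × toℕ j ≡ 0))
             → R (f i) (f j))

PathOn : ∀ {n} → Graph n → (r : ℕ) → Fin n → Fin n → Set
PathOn {n} G r x y =
  Σ (Fin r → Fin n) λ f →
    Injective _≡_ _≡_ f
    × (∀ i j → suc (toℕ i) ≡ toℕ j → Adj G (f i) (f j))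
    × (∃ λ i → toℕ i ≡ 0 × f i ≡ x)
    × (∃ λ j → toℕ j ≡ r ∸ 1 × f j ≡ y)

-- G[S] is C_ℓ-saturated relative to the complete multipartite graph on S
-- with parts S ∩ V_i: G[S] has no C_ℓ, and for every non-edge uv of G with
-- u, v ∈ S in different parts, G[S] + uv contains a C_ℓ.
-- (With S the full set this is C_ℓ-saturation of G relative to the
-- complete k-partite graph.)
SaturatedOn : ∀ {n k} → Graph n → (Fin n → Fin k) → ℕ → Subset n → Set
SaturatedOn G part ℓ S =
  ¬ CycleIn ℓ (Adj G) S
  × (∀ u v → u ∈ S → v ∈ S → part u ≢ part v → ¬ Adj G u v
       → CycleIn ℓ (AdjPlus G u v) S)

-- Every vertex outside A has a single neighbour, so it can lie neither on a
-- cycle nor in the interior of a path.  Hence every C_ℓ of G lies in G[A],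
-- which has none.  A non-edge uv with u, v ∈ A is saturated inside G[A].  If
-- u ∉ A and v ∈ A, the path on ℓ - 1 vertices from v to x_i (i the part of u)
-- avoids u, and u v … x_i u is a C_ℓ of G + uv.  If u, v ∉ A, the path on
-- ℓ - 2 vertices from x_i to x_j gives the C_ℓ  v u x_i … x_j v.
module Submission where

open import Defs hiding (sym)
open import Data.Nat using (ℕ; zero; suc; _≤_; _∸_; s≤s; z≤n; _≟_)
open import Data.Nat.Properties using (<⇒≢; m<n⇒m<1+n; n<1+n; suc-injective)
open import Data.Fin using (Fin; zero; suc; toℕ; fromℕ; inject₁; lower₁)
open import Data.Fin.Properties using (toℕ-injective; toℕ-fromℕ; toℕ-inject₁; toℕ-lower₁)
open import Data.Fin.Subset using (Subset; _∈_; _∉_; _⊆_; ⊤)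
open import Data.Fin.Subset.Properties using (_∈?_; ∈⊤)
open import Data.Vec.Functional using (_∷_)
open import Data.Product using (_×_; ∃; ∃₂; _,_)
open import Data.Sum using (_⊎_; inj₁; inj₂; [_,_])
open import Data.Bool using (T)
open import Function using (_∘_)
open import Function.Bundles using (_⇔_; Equivalence)
open import Function.Definitions using (Injective)
open import Relation.Nullary using (¬_; yes; no; contradiction)
open import Relation.Binary.PropositionalEquality
  using (_≡_; _≢_; refl; sym; trans; cong; subst; subst₂)

Consecutive : ∀ {m} → Fin m → Fin m → Set
Consecutive i j = suc (toℕ i) ≡ toℕ j

CyclicallyConsecutive : (ℓ : ℕ) → Fin ℓ → Fin ℓ → Set
CyclicallyConsecutive ℓ i j = Consecutive i j ⊎ (suc (toℕ i) ≡ ℓ × toℕ j ≡ 0)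

predecessor : ∀ {m} (k : Fin (suc m)) → toℕ k ≢ 0 → ∃ λ j → Consecutive j k
predecessor zero    k≢0 = contradiction refl k≢0
predecessor (suc k) _   = inject₁ k , cong suc (toℕ-inject₁ k)

successor : ∀ {m} (k : Fin (suc m)) → toℕ k ≢ m → ∃ λ j → Consecutive k j
successor k k≢m = suc (lower₁ k (k≢m ∘ sym)) , cong suc (sym (toℕ-lower₁ k (k≢m ∘ sym)))

consecutive-distinct : ∀ {m} {i j k : Fin m} → Consecutive i j → Consecutive j k → i ≢ k
consecutive-distinct {i = i} ij jk refl =
  <⇒≢ (m<n⇒m<1+n (n<1+n (toℕ i))) (sym (trans (cong suc ij) jk))

cyclic-neighbours : ∀ {m} (i : Fin (suc (suc (suc m)))) →
  ∃₂ λ a b → CyclicallyConsecutive (suc (suc (suc m))) a i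
           × CyclicallyConsecutive (suc (suc (suc m))) i b × a ≢ b
cyclic-neighbours {m} i with toℕ i ≟ 0 | toℕ i ≟ suc (suc m)
... | yes i≡0 | _ =
  let b , ib = successor i λ i≡2+m → 0≢2+m (trans (sym i≡0) i≡2+m)
  in fromℕ (suc (suc m)) , b , inj₂ (cong suc (toℕ-fromℕ (suc (suc m))) , i≡0) , inj₁ ib
   , λ a≡b → 2+m≢1 (trans (sym (toℕ-fromℕ _)) (trans (cong toℕ a≡b) (trans (sym ib) (cong suc i≡0))))
  where
  0≢2+m : 0 ≢ suc (suc m)
  0≢2+m ()
  2+m≢1 : suc (suc m) ≢ 1
  2+m≢1 ()
... | no i≢0 | yes i≡2+m =
  let a , ai = predecessor i i≢0
  in a , zero , inj₁ ai , inj₂ (cong suc i≡2+m , refl)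
   , λ a≡0 → 1≢2+m (trans (cong (suc ∘ toℕ) (sym a≡0)) (trans ai i≡2+m))
  where
  1≢2+m : 1 ≢ suc (suc m)
  1≢2+m ()
... | no i≢0 | no i≢2+m =
  let a , ai = predecessor i i≢0
      b , ib = successor i i≢2+m
  in a , b , inj₁ ai , inj₁ ib , consecutive-distinct ai ib

-- A path with m edges, i.e. on m + 1 vertices.
record Path {n} (R : Fin n → Fin n → Set) (m : ℕ) (a b : Fin n) : Set where
  field
    vertex    : Fin (suc m) → Fin n
    injective : Injective _≡_ _≡_ vertex
    step      : ∀ i j → Consecutive i j → R (vertex i) (vertex j)
    first     : vertex zero ≡ a
    last      : vertex (fromℕ m) ≡ b

open Path

at-first : ∀ {n} {R : Fin n → Fin n → Set} {m a b} (P : Path R m a b) →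
  ∀ q → toℕ q ≡ 0 → vertex P q ≡ a
at-first P q q≡0 = trans (cong (vertex P) (toℕ-injective q≡0)) (first P)

at-last : ∀ {n} {R : Fin n → Fin n → Set} {m a b} (P : Path R m a b) →
  ∀ q → toℕ q ≡ m → vertex P q ≡ b
at-last {m = m} P q q≡m =
  trans (cong (vertex P) (toℕ-injective (trans q≡m (sym (toℕ-fromℕ m))))) (last P)

pathOn⇒path : ∀ {n} (G : Graph n) m {a b} → PathOn G (suc m) a b → Path (Adj G) m a b
pathOn⇒path G m (f , inj , st , (i , i≡0 , fi≡a) , (j , j≡m , fj≡b)) = record
  { vertex    = f
  ; injective = inj
  ; step      = st
  ; first     = trans (cong f (toℕ-injective (sym i≡0))) fi≡a
  ; last      = trans (cong f (toℕ-injective (trans (toℕ-fromℕ m) (sym j≡m)))) fj≡b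
  }

map : ∀ {n} {R R′ : Fin n → Fin n → Set} {m a b} →
  (∀ {c d} → R c d → R′ c d) → Path R m a b → Path R′ m a b
map R⇒R′ P = record
  { vertex = vertex P ; injective = injective P ; step = λ i j ij → R⇒R′ (step P i j ij)
  ; first = first P ; last = last P }

prepend : ∀ {n} {R : Fin n → Fin n → Set} {m a b} (c : Fin n) →
  R c a → (P : Path R m a b) → (∀ q → vertex P q ≢ c) → Path R (suc m) c b
prepend {R = R} c Rca P c∉P = record
  { vertex = c ∷ vertex P ; injective = inj ; step = st ; first = refl ; last = last P }
  where
  inj : Injective _≡_ _≡_ (c ∷ vertex P)
  inj {zero}  {zero}  _ = refl
  inj {zero}  {suc q} e = contradiction (sym e) (c∉P q)
  inj {suc q} {zero}  e = contradiction e (c∉P q)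
  inj {suc p} {suc q} e = cong suc (injective P e)
  st : ∀ i j → Consecutive i j → R ((c ∷ vertex P) i) ((c ∷ vertex P) j)
  st zero    (suc j) ij = subst (R c) (sym (at-first P j (sym (suc-injective ij)))) Rca
  st (suc i) (suc j) ij = step P i j (suc-injective ij)

close : ∀ {n} {R : Fin n → Fin n → Set} {m a b} → Path R m a b → R b a → CycleIn (suc m) R ⊤
close {R = R} {m} P Rba = vertex P , injective P , (λ _ → ∈⊤) , st
  where
  st : ∀ i j → CyclicallyConsecutive (suc m) i j → R (vertex P i) (vertex P j)
  st i j (inj₁ ij) = step P i j ij
  st i j (inj₂ (i≡m , j≡0)) = subst₂ R (sym (at-last P i (suc-injective i≡m))) (sym (at-first P j j≡0)) Rba

cycleIn-map : ∀ {n ℓ} {R R′ : Fin n → Fin n → Set} {S : Subset n} →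
  (∀ {c d} → R c d → R′ c d) → CycleIn ℓ R S → CycleIn ℓ R′ S
cycleIn-map R⇒R′ (f , inj , f∈S , st) = f , inj , f∈S , λ i j ij → R⇒R′ (st i j ij)

cycleIn-⊆ : ∀ {n ℓ} {R : Fin n → Fin n → Set} {S S′ : Subset n} →
  S ⊆ S′ → CycleIn ℓ R S → CycleIn ℓ R S′
cycleIn-⊆ S⊆S′ (f , inj , f∈S , st) = f , inj , S⊆S′ ∘ f∈S , st

module _ {n} (G : Graph n) where

  Adj-sym : ∀ {a b} → Adj G a b → Adj G b a
  Adj-sym {a} {b} = subst T (Graph.sym G a b)

  AtMostOneNeighbour : Fin n → Set
  AtMostOneNeighbour w = ∀ {a b} → Adj G w a → Adj G w b → a ≡ b

  cycle-avoids-leaf : ∀ {m S} ((f , _) : CycleIn (suc (suc (suc m))) (Adj G) S) →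
    ∀ i → ¬ AtMostOneNeighbour (f i)
  cycle-avoids-leaf (f , inj , _ , st) i leaf =
    let a , b , ai , ib , a≢b = cyclic-neighbours i
    in a≢b (inj (leaf (Adj-sym (st a i ai)) (st i b ib)))

  path-avoids-leaf : ∀ {m a b w} (P : Path (Adj G) m a b) → AtMostOneNeighbour w →
    a ≢ w → b ≢ w → ∀ q → vertex P q ≢ w
  path-avoids-leaf {m} P leaf a≢w b≢w q q≡w with toℕ q ≟ 0 | toℕ q ≟ m
  ... | yes q≡0 | _       = a≢w (trans (sym (at-first P q q≡0)) q≡w)
  ... | no _    | yes q≡m = b≢w (trans (sym (at-last P q q≡m)) q≡w)
  ... | no q≢0 | no q≢m =
    let p , pq = predecessor q q≢0
        s , qs = successor q q≢m
        w~p = subst (λ v → Adj G v (vertex P p)) q≡w (Adj-sym (step P p q pq))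
        w~s = subst (λ v → Adj G v (vertex P s)) q≡w (step P q s qs)
    in consecutive-distinct pq qs (injective P (leaf w~p w~s))

  AdjPlus-swap : ∀ {u v a b} → AdjPlus G u v a b → AdjPlus G v u a b
  AdjPlus-swap = [ inj₁ , inj₂ ∘ [ inj₂ , inj₁ ] ]

module OutsideLeaves {n k} (G : Graph n) (part : Fin n → Fin k) (A : Subset n) (x : Fin k → Fin n)
  (x∈A : ∀ i → x i ∈ A)
  (neighbourhood : ∀ i u → part u ≡ i → u ∉ A → ∀ w → (Adj G u w ⇔ w ≡ x i)) where

  outside-adjacent : ∀ {u} → u ∉ A → Adj G u (x (part u))
  outside-adjacent {u} u∉A = Equivalence.from (neighbourhood (part u) u refl u∉A (x (part u))) refl

  outside-leaf : ∀ {u} → u ∉ A → AtMostOneNeighbour G u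
  outside-leaf {u} u∉A {a} {b} u~a u~b =
    trans (to a u~a) (sym (to b u~b))
    where to = λ w → Equivalence.to (neighbourhood (part u) u refl u∉A w)

  non-neighbour-outside : ∀ {u v} → u ∉ A → ¬ Adj G u v → v ≢ x (part u)
  non-neighbour-outside u∉A ¬u~v refl = ¬u~v (outside-adjacent u∉A)

  cycle-within-A : ∀ {m} →
    CycleIn (suc (suc (suc m))) (Adj G) ⊤ → CycleIn (suc (suc (suc m))) (Adj G) A
  cycle-within-A C@(f , inj , _ , st) = f , inj , f∈A , st
    where
    f∈A : ∀ i → f i ∈ A
    f∈A i with f i ∈? A
    ... | yes fi∈A = fi∈A
    ... | no  fi∉A = contradiction (λ {a b} → outside-leaf fi∉A {a} {b}) (cycle-avoids-leaf G C i)

  path-avoids-outside : ∀ {m a b u} (P : Path (Adj G) m a b) → a ∈ A → b ∈ A → u ∉ A →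
    ∀ q → vertex P q ≢ u
  path-avoids-outside P a∈A b∈A u∉A =
    path-avoids-leaf G P (outside-leaf u∉A) (λ { refl → u∉A a∈A }) (λ { refl → u∉A b∈A })

  cycle-via-outside-inside : ∀ {m} u v → u ∉ A → v ∈ A →
    Path (Adj G) m v (x (part u)) → CycleIn (suc (suc m)) (AdjPlus G u v) ⊤
  cycle-via-outside-inside u v u∉A v∈A P =
    close (prepend u (inj₂ (inj₁ (refl , refl))) (map {R′ = AdjPlus G u v} inj₁ P) u∉P)
          (inj₁ (Adj-sym G (outside-adjacent u∉A)))
    where
    u∉P : ∀ q → vertex P q ≢ u
    u∉P = path-avoids-outside P v∈A (x∈A _) u∉A

  cycle-via-two-outside : ∀ {m} u v → u ∉ A → v ∉ A → part u ≢ part v →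
    Path (Adj G) m (x (part u)) (x (part v)) → CycleIn (suc (suc (suc m))) (AdjPlus G u v) ⊤
  cycle-via-two-outside u v u∉A v∉A pu≢pv P =
    close (prepend v (inj₂ (inj₂ (refl , refl))) uP v∉uP) (inj₁ (Adj-sym G (outside-adjacent v∉A)))
    where
    P∌ : ∀ {w} → w ∉ A → ∀ q → vertex P q ≢ w
    P∌ = path-avoids-outside P (x∈A _) (x∈A _)
    uP = prepend u (inj₁ (outside-adjacent u∉A)) (map {R′ = AdjPlus G u v} inj₁ P) (P∌ u∉A)
    v∉uP : ∀ q → vertex uP q ≢ v
    v∉uP zero    u≡v = pu≢pv (cong part u≡v)
    v∉uP (suc q) = P∌ v∉A q

proposition3p1 : (ℓ n k : ℕ) → 4 ≤ ℓ →
    (G : Graph n) → (part : Fin n → Fin k) → IsPartite G part →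
    (A : Subset n) → (x : Fin k → Fin n) → (∀ i → x i ∈ A) →
    (∀ i u → part u ≡ i → u ∉ A → ∀ w → (Adj G u w ⇔ w ≡ x i)) →
    (∀ i y → y ∈ A → part y ≢ i → y ≢ x i → PathOn G (ℓ ∸ 1) y (x i)) →
    (∀ i j → i ≢ j → PathOn G (ℓ ∸ 2) (x i) (x j)) →
    SaturatedOn G part ℓ A →
    SaturatedOn G part ℓ ⊤
proposition3p1 _ _ _ (s≤s (s≤s (s≤s (s≤s (z≤n {m}))))) G part _ A x x∈A neighbourhood long short
  (C-freeA , saturatedA) = C-freeA ∘ cycle-within-A , saturated
  where
  open OutsideLeaves G part A x x∈A neighbourhood
  saturated : ∀ u v → u ∈ ⊤ → v ∈ ⊤ → part u ≢ part v → ¬ Adj G u v →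
    CycleIn (suc (suc (suc (suc m)))) (AdjPlus G u v) ⊤
  saturated u v _ _ pu≢pv ¬u~v with u ∈? A | v ∈? A
  ... | yes u∈A | yes v∈A =
    cycleIn-⊆ {R = AdjPlus G u v} (λ _ → ∈⊤) (saturatedA u v u∈A v∈A pu≢pv ¬u~v)
  ... | no u∉A | yes v∈A = cycle-via-outside-inside u v u∉A v∈A
    (pathOn⇒path G _ (long (part u) v v∈A (pu≢pv ∘ sym) (non-neighbour-outside u∉A ¬u~v)))
  ... | yes u∈A | no v∉A = cycleIn-map {R = AdjPlus G v u} (AdjPlus-swap G)
    (cycle-via-outside-inside v u v∉A u∈A
      (pathOn⇒path G _ (long (part v) u u∈A pu≢pv (non-neighbour-outside v∉A (¬u~v ∘ Adj-sym G)))))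
  ... | no u∉A | no v∉A = cycle-via-two-outside u v u∉A v∉A pu≢pv
    (pathOn⇒path G _ (short (part u) (part v) pu≢pv))
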